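{- Let $k \ge 2$ be an integer and let $S=(s_1,s_2,\ldots)$ be a packing sequence with $S \in \mathcal{S}(k)$, i.e. $2^{i-1} \le s_i < 2^i$ for all $i \le k-1$ and $s_k < 2^{k-1}$. Then for every path $P_n$ of order $n \ge 1$, $$\chi_S(P_n) = \min\{k, \lfloor \log_2(n) \rfloor + 1\}.$$ In particular, if $n \ge 2^{k-1}$, then $\chi_S(P_n) = k$.
   Context: A packing sequence is a non-decreasing infinite sequence $S=(s_1,s_2,\ldots)$ of positive integers. For a graph $G$, a map $\phi\colon V(G)\to\{1,\ldots,k\}$ is an $S$-packing $k$-coloring if any two distinct vertices $u,v$ with $\phi(u)=\phi(v)=i$ satisfy $d_G(u,v) > s_i$. The $S$-packing chromatic number $\chi_S(G)$ is the least $k$ for which such a coloring exists. $P_n$ denotes the path on $n$ vertices. For an integer $k\ge 2$, $\mathcal{S}(k)$ is the set of packing sequences with $2^{i-1}\le s_i<2^i$ for all $i\le k-1$ and $s_k<2^{k-1}$ (so in particular $s_1=1$). -}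

module Defs where

open import Data.Nat using (ℕ; zero; suc; _+_; _^_; _≤_; _<_; _∸_; ∣_-_∣)
open import Data.Fin using (Fin; toℕ)
open import Data.Product using (Σ; _×_)
open import Relation.Binary.PropositionalEquality using (_≡_)
open import Relation.Nullary using (¬_)

-- A packing sequence S = (s_1, s_2, ...): represented as a function ℕ → ℕ,
-- where only the values at indices i ≥ 1 are meaningful (s 0 is ignored).
record PackingSequence : Set where
  field
    s        : ℕ → ℕ
    positive : ∀ i → 1 ≤ i → 1 ≤ s i
    monotone : ∀ i j → 1 ≤ i → i ≤ j → s i ≤ s j
open PackingSequence public

-- The path P_n: vertex set Fin n, with i adjacent to i+1.
-- Its graph distance is d(u,v) = |u - v|.
pathDist : {n : ℕ} → Fin n → Fin n → ℕ
pathDist u v = ∣ toℕ u - toℕ v ∣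

-- An S-packing k-coloring of P_n. Colours are {1,…,k}, represented by
-- Fin k with Fin-value c standing for colour (toℕ c + 1).
IsPackingColoring : PackingSequence → (n k : ℕ) → (Fin n → Fin k) → Set
IsPackingColoring S n k φ =
  ∀ u v → ¬ (u ≡ v) → φ u ≡ φ v → s S (suc (toℕ (φ u))) < pathDist u v

PackingColorable : PackingSequence → (n k : ℕ) → Set
PackingColorable S n k = Σ (Fin n → Fin k) (IsPackingColoring S n k)

ChiPath≡ : PackingSequence → (n m : ℕ) → Set
ChiPath≡ S n m = PackingColorable S n m × (∀ k → k < m → ¬ PackingColorable S n k)

InSk : ℕ → PackingSequence → Set
InSk k S =
  (∀ i → 1 ≤ i → i ≤ k ∸ 1 → (2 ^ (i ∸ 1) ≤ s S i) × (s S i < 2 ^ i))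
  × (s S k < 2 ^ (k ∸ 1))

{-# OPTIONS --safe #-}
-- Lower bound: if 2^i ≤ s_{i+1} for all i < j, then no j colours pack 2^j consecutive
-- vertices.  By packing, the last colour occurs at most once among the first 2^(j-1) of
-- them, and the 2^(j-1) vertices before (if it does not occur) or right after that
-- occurrence form a block packed by the remaining j-1 colours.
-- Upper bound: number the vertices 1, …, n and colour x by its 2-adic valuation capped at
-- m = min(k-1, ⌊log₂ n⌋).  Colour c < m is the progression 2^c + 2^(c+1)ℕ, whose points
-- are 2^(c+1) > s_{c+1} apart; the capped colour 2^m ℕ is either sparse enough (m = k-1
-- and s_k < 2^(k-1)) or meets P_n only in 2^m (n < 2^(m+1)).
module Submission where

open import Data.Fin using (Fin; toℕ; fromℕ<)
open import Data.Fin.Properties using (toℕ-fromℕ<; toℕ-injective; toℕ<n)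
open import Data.Nat
open import Data.Nat.DivMod using (_mod_; m<n⇒m%n≡m)
open import Data.Nat.Logarithm using (⌊log₂_⌋; ⌊log₂⌋-mono-≤; ⌊log₂[2^n]⌋≡n)
open import Data.Nat.Logarithm.Core using (⌊log2⌋)
open import Data.Nat.Properties
open import Data.Product using (Σ; ∃; _×_; _,_; proj₁; proj₂)
open import Data.Sum using (_⊎_; inj₁; inj₂)
open import Function using (_∘_)
open import Induction.WellFounded using (Acc; acc)
open import Relation.Binary.PropositionalEquality
open import Relation.Nullary using (Dec; ¬_; yes; no; contradiction)

open import Defs

private
  variable
    c j k m n x y : ℕ

2^⌊log2⌋n≤n : ∀ n (rec : Acc _<_ n) → 0 < n → 2 ^ ⌊log2⌋ n rec ≤ n
2^⌊log2⌋n≤n 1             _        _ = ≤-refl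
2^⌊log2⌋n≤n (suc (suc n)) (acc rs) _ = begin
  2 * 2 ^ ⌊log2⌋ (suc h) _ ≤⟨ *-monoʳ-≤ 2 (2^⌊log2⌋n≤n (suc h) _ z<s) ⟩
  2 * suc h               ≡⟨ *-suc 2 h ⟩
  2 + (h + (h + 0))       ≤⟨ +-monoʳ-≤ 2 2*h≤n ⟩
  2 + n                   ∎
  where
  open ≤-Reasoning
  h : ℕ
  h = ⌊ n /2⌋
  2*h≤n : h + (h + 0) ≤ n
  2*h≤n = begin
    h + (h + 0)   ≡⟨ cong (h +_) (+-identityʳ h) ⟩
    h + h         ≤⟨ +-monoʳ-≤ h (⌊n/2⌋≤⌈n/2⌉ n) ⟩
    h + ⌈ n /2⌉   ≡⟨ ⌊n/2⌋+⌈n/2⌉≡n n ⟩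
    n             ∎

2^⌊log₂n⌋≤n : 0 < n → 2 ^ ⌊log₂ n ⌋ ≤ n
2^⌊log₂n⌋≤n = 2^⌊log2⌋n≤n _ _

n<2^[1+⌊log₂n⌋] : ∀ n → n < 2 ^ suc ⌊log₂ n ⌋
n<2^[1+⌊log₂n⌋] n = ≰⇒> λ 2^[1+L]≤n →
  1+n≰n (subst (_≤ ⌊log₂ n ⌋) (⌊log₂[2^n]⌋≡n (suc ⌊log₂ n ⌋)) (⌊log₂⌋-mono-≤ 2^[1+L]≤n))

even⊎odd : ∀ x → (∃ λ h → x ≡ 2 * h) ⊎ (∃ λ q → x ≡ 1 + 2 * q)
even⊎odd zero    = inj₁ (0 , refl)
even⊎odd (suc x) with even⊎odd x
... | inj₁ (h , x≡2h)   = inj₂ (h , cong suc x≡2h)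
... | inj₂ (q , x≡1+2q) = inj₁ (suc q , trans (cong suc x≡1+2q) (sym (*-suc 2 q)))

m≤∣m*n-m*o∣ : ∀ m {n o} → n ≢ o → m ≤ ∣ m * n - m * o ∣
m≤∣m*n-m*o∣ m {n} {o} n≢o = begin
  m                 ≡⟨ *-identityʳ m ⟨
  m * 1             ≤⟨ *-monoʳ-≤ m (n≢0⇒n>0 (n≢o ∘ ∣m-n∣≡0⇒m≡n)) ⟩
  m * ∣ n - o ∣     ≡⟨ *-distribˡ-∣-∣ m n o ⟩
  ∣ m * n - m * o ∣ ∎
  where open ≤-Reasoning

0<m*n<m*2⇒n≡1 : ∀ m {n} → 0 < m * n → m * n < m * 2 → n ≡ 1
0<m*n<m*2⇒n≡1 m {zero}        0<m*0 _ = contradiction (subst (0 <_) (*-zeroʳ m) 0<m*0) (n≮n 0)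
0<m*n<m*2⇒n≡1 m {suc zero}    _ _     = refl
0<m*n<m*2⇒n≡1 m {suc (suc n)} _ lt    = contradiction (*-cancelˡ-< m _ 2 lt) λ { (s<s (s<s ())) }

-- RulerClass m x c: the 2-adic valuation of x capped at m is c (x = 0 is capped).
data RulerClass (m x : ℕ) : ℕ → Set where
  below  : ∀ {c} q → c < m → x ≡ 2 ^ c + 2 ^ suc c * q → RulerClass m x c
  capped : ∀ q → x ≡ 2 ^ m * q → RulerClass m x m

rulerClass : ∀ m x → ∃ (RulerClass m x)
rulerClass zero    x = 0 , capped x (sym (*-identityˡ x))
rulerClass (suc m) x with even⊎odd x
... | inj₂ (q , x≡1+2q) = 0 , below q z<s x≡1+2q
... | inj₁ (h , x≡2h) with rulerClass m h
...   | c , below q c<m h≡ = suc c , below q (s<s c<m) (begin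
  x                                           ≡⟨ x≡2h ⟩
  2 * h                                       ≡⟨ cong (2 *_) h≡ ⟩
  2 * (2 ^ c + 2 ^ suc c * q)                 ≡⟨ *-distribˡ-+ 2 (2 ^ c) _ ⟩
  2 ^ suc c + 2 * (2 ^ suc c * q)             ≡⟨ cong (2 ^ suc c +_) (*-assoc 2 (2 ^ suc c) q) ⟨
  2 ^ suc c + 2 ^ suc (suc c) * q             ∎)
  where open ≡-Reasoning
...   | .m , capped q h≡ = suc m , capped q (begin
  x                  ≡⟨ x≡2h ⟩
  2 * h              ≡⟨ cong (2 *_) h≡ ⟩
  2 * (2 ^ m * q)    ≡⟨ *-assoc 2 (2 ^ m) q ⟨
  2 ^ suc m * q      ∎)
  where open ≡-Reasoning

rulerClass⇒≤ : RulerClass m x c → c ≤ m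
rulerClass⇒≤ (below _ c<m _) = <⇒≤ c<m
rulerClass⇒≤ (capped _ _)    = ≤-refl

below-far : c < m → RulerClass m x c → RulerClass m y c → x ≢ y → 2 ^ suc c ≤ ∣ x - y ∣
below-far {c} _ (below q _ x≡) (below r _ y≡) x≢y rewrite x≡ | y≡ =
  subst (2 ^ suc c ≤_) (sym (∣m+n-m+o∣≡∣n-o∣ (2 ^ c) _ _))
    (m≤∣m*n-m*o∣ (2 ^ suc c) (x≢y ∘ cong (λ t → 2 ^ c + 2 ^ suc c * t)))
below-far m<m (below _ _ _) (capped _ _) _ = contradiction m<m (n≮n _)
below-far m<m (capped _ _)  _            _ = contradiction m<m (n≮n _)

capped⇒multiple : RulerClass m x m → ∃ λ q → x ≡ 2 ^ m * q
capped⇒multiple (below _ m<m _) = contradiction m<m (n≮n _)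
capped⇒multiple (capped q x≡)   = q , x≡

capped-far : RulerClass m x m → RulerClass m y m → x ≢ y → 2 ^ m ≤ ∣ x - y ∣
capped-far {m} cx cy x≢y with capped⇒multiple cx | capped⇒multiple cy
... | q , x≡ | r , y≡ rewrite x≡ | y≡ = m≤∣m*n-m*o∣ (2 ^ m) (x≢y ∘ cong (2 ^ m *_))

capped-unique : RulerClass m x m → 0 < x → x < 2 ^ suc m → x ≡ 2 ^ m
capped-unique {m} {x} cx 0<x x<2^[1+m] with capped⇒multiple cx
... | q , x≡ = begin
  x          ≡⟨ x≡ ⟩
  2 ^ m * q  ≡⟨ cong (2 ^ m *_) (0<m*n<m*2⇒n≡1 (2 ^ m) (subst (0 <_) x≡ 0<x)
                  (subst₂ _<_ x≡ (*-comm 2 (2 ^ m)) x<2^[1+m])) ⟩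
  2 ^ m * 1  ≡⟨ *-identityʳ (2 ^ m) ⟩
  2 ^ m      ∎
  where open ≡-Reasoning

module _ (S : PackingSequence) where

  -- Packing colourings of the first n vertices 0, 1, …, n-1 of the one-way infinite
  -- path, with the colours (0-based, as in Defs) as plain naturals.
  IsPrefixPacking : ℕ → (ℕ → ℕ) → Set
  IsPrefixPacking n col =
    ∀ {x y} → x < n → y < n → x ≢ y → col x ≡ col y → s S (suc (col x)) < ∣ x - y ∣

  PrefixColorable : (n k : ℕ) → Set
  PrefixColorable n k =
    Σ (ℕ → ℕ) λ col → (∀ {x} → x < n → col x < k) × IsPrefixPacking n col

  prefixColorable⇒packingColorable : PrefixColorable n k → PackingColorable S n k
  prefixColorable⇒packingColorable {n} {k} (col , col<k , packed) = φ , φ-packed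
    where
    φ : Fin n → Fin k
    φ u = fromℕ< (col<k (toℕ<n u))
    toℕ-φ : ∀ u → toℕ (φ u) ≡ col (toℕ u)
    toℕ-φ u = toℕ-fromℕ< (col<k (toℕ<n u))
    φ-packed : IsPackingColoring S n k φ
    φ-packed u v u≢v φu≡φv rewrite toℕ-φ u =
      packed (toℕ<n u) (toℕ<n v) (u≢v ∘ toℕ-injective)
        (trans (sym (toℕ-φ u)) (trans (cong toℕ φu≡φv) (toℕ-φ v)))

  packingColorable⇒prefixColorable : .{{_ : NonZero n}} →
                                     PackingColorable S n k → PrefixColorable n k
  packingColorable⇒prefixColorable {n} (φ , φ-packed) = col , (λ _ → toℕ<n _) , packed
    where
    col : ℕ → ℕ
    col x = toℕ (φ (x mod n))
    toℕ-mod : x < n → toℕ (x mod n) ≡ x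
    toℕ-mod x<n = trans (toℕ-fromℕ< _) (m<n⇒m%n≡m x<n)
    packed : IsPrefixPacking n col
    packed {x} {y} x<n y<n x≢y colx≡coly =
      subst (s S (suc (col x)) <_) (cong₂ ∣_-_∣ (toℕ-mod x<n) (toℕ-mod y<n))
        (φ-packed (x mod n) (y mod n)
          (λ x≡y → x≢y (trans (sym (toℕ-mod x<n)) (trans (cong toℕ x≡y) (toℕ-mod y<n))))
          (toℕ-injective colx≡coly))

  isPrefixPacking-window : ∀ {col} a → a + m ≤ n → IsPrefixPacking n col →
                           IsPrefixPacking m (λ x → col (a + x))
  isPrefixPacking-window {m} {n} {col} a a+m≤n packed {x} {y} x<m y<m x≢y e =
    subst (s S (suc (col (a + x))) <_) (∣m+n-m+o∣≡∣n-o∣ a x y)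
      (packed (inside x<m) (inside y<m) (x≢y ∘ +-cancelˡ-≡ a x y) e)
    where
    inside : ∀ {z} → z < m → a + z < n
    inside z<m = <-≤-trans (+-monoʳ-< a z<m) a+m≤n

  prefixColorable-mono : m ≤ n → PrefixColorable n k → PrefixColorable m k
  prefixColorable-mono m≤n (col , col<k , packed) =
    col , (λ x<m → col<k (<-≤-trans x<m m≤n)) , isPrefixPacking-window 0 m≤n packed

  prefixColorable-halve : 2 ^ j ≤ s S (suc j) →
                          PrefixColorable (2 ^ suc j) (suc j) → PrefixColorable (2 ^ j) j
  prefixColorable-halve {j} 2^j≤s (col , col<1+j , packed) =
    from-search (anyUpTo? (λ x → col x ≟ j) (2 ^ j))
    where
    2^j≤2^[1+j] : 2 ^ j ≤ 2 ^ suc j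
    2^j≤2^[1+j] = ^-monoʳ-≤ 2 (n≤1+n j)
    from-search : Dec (∃ λ p → p < 2 ^ j × col p ≡ j) → PrefixColorable (2 ^ j) j
    from-search (no ∄) =
      col , (λ x<2^j → ≤∧≢⇒< (s≤s⁻¹ (col<1+j (<-≤-trans x<2^j 2^j≤2^[1+j])))
                               (λ colx≡j → ∄ (_ , x<2^j , colx≡j)))
          , isPrefixPacking-window 0 2^j≤2^[1+j] packed
    from-search (yes (p , p<2^j , colp≡j)) =
      (λ x → col (suc p + x))
      , (λ x<2^j → ≤∧≢⇒< (s≤s⁻¹ (col<1+j (after x<2^j))) (j-not-repeated x<2^j))
      , isPrefixPacking-window (suc p) window≤2^[1+j] packed
      where
      window≤2^[1+j] : suc p + 2 ^ j ≤ 2 ^ suc j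
      window≤2^[1+j] = ≤-trans (+-monoˡ-≤ (2 ^ j) p<2^j)
                               (≤-reflexive (cong (2 ^ j +_) (sym (+-identityʳ (2 ^ j)))))
      after : x < 2 ^ j → suc p + x < 2 ^ suc j
      after x<2^j = <-≤-trans (+-monoʳ-< (suc p) x<2^j) window≤2^[1+j]
      j-not-repeated : x < 2 ^ j → col (suc p + x) ≢ j
      j-not-repeated {x} x<2^j col≡j = ≤⇒≯ 2^j≤s (begin-strict
        s S (suc j)        ≡⟨ cong (s S ∘ suc) (sym colp≡j) ⟩
        s S (suc (col p))  <⟨ packed (<-≤-trans p<2^j 2^j≤2^[1+j]) (after x<2^j) (m≢1+m+n p)
                                     (trans colp≡j (sym col≡j)) ⟩
        ∣ p - suc p + x ∣  ≡⟨ cong (∣ p -_∣) (sym (+-suc p x)) ⟩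
        ∣ p - p + suc x ∣  ≡⟨ ∣m-m+n∣≡n p (suc x) ⟩
        suc x              ≤⟨ x<2^j ⟩
        2 ^ j              ∎)
        where open ≤-Reasoning

  ¬prefixColorable[2^j] : ∀ j → (∀ {i} → i < j → 2 ^ i ≤ s S (suc i)) → ¬ PrefixColorable (2 ^ j) j
  ¬prefixColorable[2^j] zero    _     (col , col<0 , _) = n≮0 (col<0 z<s)
  ¬prefixColorable[2^j] (suc j) 2^i≤s =
    ¬prefixColorable[2^j] j (2^i≤s ∘ m<n⇒m<1+n) ∘ prefixColorable-halve (2^i≤s (n<1+n j))

  ¬packingColorable : 2 ^ j ≤ n → (∀ {i} → i < j → 2 ^ i ≤ s S (suc i)) → ¬ PackingColorable S n j
  ¬packingColorable {j} {n} 2^j≤n 2^i≤s =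
    ¬prefixColorable[2^j] j 2^i≤s ∘ prefixColorable-mono 2^j≤n ∘ packingColorable⇒prefixColorable
    where
    instance
      n≢0 : NonZero n
      n≢0 = >-nonZero (<-≤-trans (m^n>0 2 j) 2^j≤n)

  rulerClass-packed : (∀ {c} → c < m → s S (suc c) < 2 ^ suc c) →
                      s S (suc m) < 2 ^ m ⊎ n < 2 ^ suc m →
                      RulerClass m (suc x) c → RulerClass m (suc y) c →
                      x < n → y < n → x ≢ y → s S (suc c) < ∣ x - y ∣
  rulerClass-packed s<2^[1+c] _ cx@(below _ c<m _) cy _ _ x≢y =
    <-≤-trans (s<2^[1+c] c<m) (below-far c<m cx cy (x≢y ∘ suc-injective))
  rulerClass-packed _ (inj₁ s<2^m) cx@(capped _ _) cy _ _ x≢y =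
    <-≤-trans s<2^m (capped-far cx cy (x≢y ∘ suc-injective))
  rulerClass-packed _ (inj₂ n<2^[1+m]) cx@(capped _ _) cy x<n y<n x≢y =
    contradiction (suc-injective (trans (capped-unique cx z<s (≤-<-trans x<n n<2^[1+m]))
                                        (sym (capped-unique cy z<s (≤-<-trans y<n n<2^[1+m])))))
                  x≢y

  rulerPrefixColorable : ∀ m → (∀ {c} → c < m → s S (suc c) < 2 ^ suc c) →
                         s S (suc m) < 2 ^ m ⊎ n < 2 ^ suc m → PrefixColorable n (suc m)
  rulerPrefixColorable {n} m s<2^[1+c] capped-sparse =
    col , (λ _ → s≤s (rulerClass⇒≤ (class _))) , packed
    where
    col : ℕ → ℕ
    col x = proj₁ (rulerClass m (suc x))
    class : ∀ x → RulerClass m (suc x) (col x)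
    class x = proj₂ (rulerClass m (suc x))
    packed : IsPrefixPacking n col
    packed {x} {y} x<n y<n x≢y colx≡coly =
      rulerClass-packed s<2^[1+c] capped-sparse
        (class x) (subst (RulerClass m (suc y)) (sym colx≡coly) (class y)) x<n y<n x≢y

theorem3p1 : (k : ℕ) → 2 ≤ k → (S : PackingSequence) → InSk k S →
    (n : ℕ) → 1 ≤ n → ChiPath≡ S n (k ⊓ suc ⌊log₂ n ⌋)
theorem3p1 (suc k₀) _ S S∈𝒮 n 0<n = upper , lower
  where
  L top : ℕ
  L = ⌊log₂ n ⌋
  top = k₀ ⊓ L
  2^i≤s : ∀ {i} → i < k₀ → 2 ^ i ≤ s S (suc i)
  2^i≤s i<k₀ = proj₁ (proj₁ S∈𝒮 _ z<s i<k₀)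
  s<2^[1+i] : ∀ {i} → i < k₀ → s S (suc i) < 2 ^ suc i
  s<2^[1+i] i<k₀ = proj₂ (proj₁ S∈𝒮 _ z<s i<k₀)
  capped-sparse : s S (suc top) < 2 ^ top ⊎ n < 2 ^ suc top
  capped-sparse with ⊓-sel k₀ L
  ... | inj₁ top≡k₀ rewrite top≡k₀ = inj₁ (proj₂ S∈𝒮)
  ... | inj₂ top≡L  rewrite top≡L  = inj₂ (n<2^[1+⌊log₂n⌋] n)
  upper : PackingColorable S n (suc top)
  upper = prefixColorable⇒packingColorable S
    (rulerPrefixColorable S top (λ c<top → s<2^[1+i] (<-≤-trans c<top (m⊓n≤m k₀ L))) capped-sparse)
  lower : ∀ j → j < suc top → ¬ PackingColorable S n j
  lower j (s≤s j≤top) = ¬packingColorable S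
    (≤-trans (^-monoʳ-≤ 2 (≤-trans j≤top (m⊓n≤n k₀ L))) (2^⌊log₂n⌋≤n 0<n))
    (λ i<j → 2^i≤s (<-≤-trans i<j (≤-trans j≤top (m⊓n≤m k₀ L))))
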